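{- Fix any integers $k\leq n$. Then any NFA $M$ with $L(M)=L_k(n)$ has at least $2^k$ states.
   Context: For integers $k\leq n$, $L_k(n)\subseteq [n]^k$ is the set of words $w_1\cdots w_k\in[n]^k$ such that $w_1,\ldots,w_k$ are all distinct. An NFA over alphabet $[n]$ is a nondeterministic finite automaton (a directed graph of states with transitions labeled by elements of $[n]$, a start state and a set of accepting states); $L(M)$ is the set of words labeling a path from the start state to an accepting state. -}

module Defs where

open import Data.Nat using (ℕ)
open import Data.Fin using (Fin)
open import Data.Bool using (Bool; true)
open import Data.List using (List; []; _∷_; length)
open import Data.List.Relation.Unary.Unique.Propositional using (Unique)
open import Relation.Binary.PropositionalEquality using (_≡_)
open import Data.Product using (_×_)
open import Function.Bundles using (_⇔_)

-- An NFA over the alphabet [n] = Fin n with a finite set of states Fin (states).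
-- The transition relation is a (decidable) relation: δ q a q' ≡ true means
-- there is a transition q --a--> q'.
record NFA (n : ℕ) : Set where
  field
    states    : ℕ
    start     : Fin states
    accepting : Fin states → Bool
    δ         : Fin states → Fin n → Fin states → Bool

open NFA public

data Run {n : ℕ} (M : NFA n) : Fin (states M) → List (Fin n) → Fin (states M) → Set where
  run-nil  : ∀ {q} → Run M q [] q
  run-cons : ∀ {q q' q''} {a w} → δ M q a q' ≡ true → Run M q' w q'' → Run M q (a ∷ w) q''

data Accepts {n : ℕ} (M : NFA n) (w : List (Fin n)) : Set where
  accepts : ∀ {q} → Run M (start M) w q → accepting M q ≡ true → Accepts M w

InLk : (k n : ℕ) → List (Fin n) → Set
InLk k n w = (length w ≡ k) × Unique w

Recognises : {n : ℕ} → NFA n → ℕ → Set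
Recognises {n} M k = ∀ (w : List (Fin n)) → Accepts M w ⇔ InLk k n w

-- Fooling-set argument. Encode each subset S ⊆ [k] by the word x_S y_S listing
-- S and then its complement, both in increasing order; it lies in L_k(n). Fix an
-- accepting run for each S and let q_S be its state after reading x_S. If
-- q_S = q_T then x_S y_T is accepted, so it has k distinct letters: distinctness
-- forces S ⊆ T, and k distinct letters from [k] cover [k], forcing T ⊆ S. Hence
-- S ↦ q_S is injective on the 2^k subsets.
module Submission where

open import Defs
open import Level using (Level)
open import Data.Nat using (ℕ; _≤_; _^_; _+_; suc)
open import Data.Nat.Properties using (+-suc; <-irrefl)
open import Data.Fin using (Fin; zero; suc; inject≤; finToFun; funToFin; combine)
open import Data.Fin.Properties
  using (inject≤-injective; injective⇒≤; funToFin-finToFin; _≟_)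
open import Data.List using (List; []; _∷_; _++_; map; filter; length; lookup; allFin)
open import Data.List.Properties using (length-++; length-map; length-tabulate; map-++)
open import Data.List.Membership.Propositional using (_∈_)
open import Data.List.Membership.Propositional.Properties
  using (∈-lookup; ∈-++⁺ʳ; ∈-++⁻; ∈-filter⁺; ∈-filter⁻; ∈-allFin)
import Data.List.Membership.DecPropositional as DecMembership
open import Data.List.Relation.Unary.Any using (here; there)
import Data.List.Relation.Unary.All as All
open import Data.List.Relation.Unary.All.Properties using (¬Any⇒All¬)
open import Data.List.Relation.Unary.AllPairs using (_∷_)
open import Data.List.Relation.Unary.Unique.Propositional using (Unique)
import Data.List.Relation.Unary.Unique.Propositional.Properties as Unique
open import Data.List.Relation.Binary.Disjoint.Propositional using (Disjoint)
open import Data.Bool using (true)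
open import Data.Product using (∃; _×_; _,_; proj₁; proj₂)
open import Data.Sum using (inj₁; inj₂)
open import Function using (_∘_)
open import Function.Bundles using (_⇔_; mk⇔; Equivalence)
open import Function.Definitions using (Injective)
open import Relation.Nullary using (yes; no; contradiction)
open import Relation.Nullary.Decidable using (decidable-stable)
open import Relation.Unary using (Pred; Decidable)
open import Relation.Unary.Properties using (∁?)
open import Relation.Binary.PropositionalEquality
  using (_≡_; _≗_; refl; sym; trans; cong; cong₂; subst; module ≡-Reasoning)

private
  variable
    a ℓ : Level
    A : Set a
    k m n : ℕ

Unique⇒lookup-injective : {xs : List A} → Unique xs → Injective _≡_ _≡_ (lookup xs)
Unique⇒lookup-injective (_ ∷ _)   {zero}  {zero}  _  = refl
Unique⇒lookup-injective (x∉ ∷ _)  {zero}  {suc j} eq =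
  contradiction eq (All.lookup x∉ (∈-lookup j))
Unique⇒lookup-injective (x∉ ∷ _)  {suc i} {zero}  eq =
  contradiction (sym eq) (All.lookup x∉ (∈-lookup i))
Unique⇒lookup-injective (_ ∷ xs!) {suc i} {suc j} eq =
  cong suc (Unique⇒lookup-injective xs! eq)

Unique⇒length≤ : {xs : List (Fin n)} → Unique xs → length xs ≤ n
Unique⇒length≤ xs! = injective⇒≤ (Unique⇒lookup-injective xs!)

Unique∧length≡⇒∈ : {xs : List (Fin n)} → Unique xs → length xs ≡ n → ∀ i → i ∈ xs
Unique∧length≡⇒∈ {xs = xs} xs! len i with DecMembership._∈?_ _≟_ i xs
... | yes i∈xs = i∈xs
... | no  i∉xs = contradiction (Unique⇒length≤ (¬Any⇒All¬ xs i∉xs ∷ xs!)) (<-irrefl len)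

Unique-++⇒Disjoint : ∀ (xs : List A) {ys} → Unique (xs ++ ys) → Disjoint xs ys
Unique-++⇒Disjoint (_ ∷ xs) (x∉ ∷ _)   (here refl , v∈ys) =
  All.lookup x∉ (∈-++⁺ʳ xs v∈ys) refl
Unique-++⇒Disjoint (_ ∷ xs) (_ ∷ xs!) (there v∈xs , v∈ys) =
  Unique-++⇒Disjoint xs xs! (v∈xs , v∈ys)

length-filter+length-filter-∁ : {P : Pred A ℓ} (P? : Decidable P) (xs : List A) →
  length (filter P? xs) + length (filter (∁? P?) xs) ≡ length xs
length-filter+length-filter-∁ P? []       = refl
length-filter+length-filter-∁ P? (x ∷ xs) with P? x
... | yes _ = cong suc (length-filter+length-filter-∁ P? xs)
... | no  _ = trans (+-suc _ _) (cong suc (length-filter+length-filter-∁ P? xs))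

InLk-map⁺ : {f : Fin m → Fin n} {w : List (Fin m)} →
  Injective _≡_ _≡_ f → InLk k m w → InLk k n (map f w)
InLk-map⁺ {f = f} {w} f-inj (len , w!) = trans (length-map f w) len , Unique.map⁺ f-inj w!

InLk-map⁻ : {f : Fin m → Fin n} {w : List (Fin m)} → InLk k n (map f w) → InLk k m w
InLk-map⁻ {f = f} {w} (len , fw!) = trans (sym (length-map f w)) len , Unique.map⁻ fw!

elements : {P : Pred (Fin k) ℓ} → Decidable P → List (Fin k)
elements {k = k} P? = filter P? (allFin k)

∈-elements⁺ : {P : Pred (Fin k) ℓ} (P? : Decidable P) → ∀ {i} → P i → i ∈ elements P?
∈-elements⁺ P? {i} = ∈-filter⁺ P? {xs = allFin _} (∈-allFin i)

∈-elements⁻ : {P : Pred (Fin k) ℓ} (P? : Decidable P) → ∀ {i} → i ∈ elements P? → P i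
∈-elements⁻ P? = proj₂ ∘ ∈-filter⁻ P? {xs = allFin _}

module _ {P : Pred (Fin k) ℓ} (P? : Decidable P) where

  elements++elements-∁∈Lk : InLk k k (elements P? ++ elements (∁? P?))
  elements++elements-∁∈Lk = length≡k , Unique.++⁺ (unique P?) (unique (∁? P?)) disjoint
    where
    unique : ∀ {Q : Pred (Fin k) ℓ} (Q? : Decidable Q) → Unique (elements Q?)
    unique Q? = Unique.filter⁺ Q? (Unique.allFin⁺ k)

    disjoint : Disjoint (elements P?) (elements (∁? P?))
    disjoint (i∈P , i∈∁P) = ∈-elements⁻ (∁? P?) i∈∁P (∈-elements⁻ P? i∈P)

    open ≡-Reasoning
    length≡k : length (elements P? ++ elements (∁? P?)) ≡ k
    length≡k = begin
      length (elements P? ++ elements (∁? P?))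
        ≡⟨ length-++ (elements P?) ⟩
      length (elements P?) + length (elements (∁? P?))
        ≡⟨ length-filter+length-filter-∁ P? (allFin k) ⟩
      length (allFin k)
        ≡⟨ length-tabulate _ ⟩
      k ∎

elements++elements-∁∈Lk⇒⇔ : {P Q : Pred (Fin k) ℓ} (P? : Decidable P) (Q? : Decidable Q) →
  InLk k k (elements P? ++ elements (∁? Q?)) → ∀ i → P i ⇔ Q i
elements++elements-∁∈Lk⇒⇔ {P = P} {Q} P? Q? (len , w!) i = mk⇔ P⇒Q Q⇒P
  where
  P⇒Q : P i → Q i
  P⇒Q p = decidable-stable (Q? i) λ ¬q →
    Unique-++⇒Disjoint (elements P?) w! (∈-elements⁺ P? p , ∈-elements⁺ (∁? Q?) ¬q)

  Q⇒P : Q i → P i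
  Q⇒P q with ∈-++⁻ (elements P?) (Unique∧length≡⇒∈ w! len i)
  ... | inj₁ i∈P  = ∈-elements⁻ P? i∈P
  ... | inj₂ i∈∁Q = contradiction q (∈-elements⁻ (∁? Q?) i∈∁Q)

funToFin-cong : {f g : Fin m → Fin n} → f ≗ g → funToFin f ≡ funToFin g
funToFin-cong {m = ℕ.zero}  f≗g = refl
funToFin-cong {m = suc m} f≗g = cong₂ combine (f≗g zero) (funToFin-cong (f≗g ∘ suc))

finToFun-injective : {i j : Fin (m ^ n)} → finToFun {m} {n} i ≗ finToFun j → i ≡ j
finToFun-injective {m = m} {n} {i} {j} i≗j = begin
  i                             ≡⟨ sym (funToFin-finToFin {n} {m} i) ⟩
  funToFin (finToFun {m} {n} i) ≡⟨ funToFin-cong i≗j ⟩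
  funToFin (finToFun {m} {n} j) ≡⟨ funToFin-finToFin {n} {m} j ⟩
  j                             ∎
  where open ≡-Reasoning

≡0⇔≡0⇒≡ : {a b : Fin 2} → a ≡ zero ⇔ b ≡ zero → a ≡ b
≡0⇔≡0⇒≡ {zero}      {zero}      _ = refl
≡0⇔≡0⇒≡ {zero}      {suc zero}  a≡0⇔b≡0 with () ← Equivalence.to a≡0⇔b≡0 refl
≡0⇔≡0⇒≡ {suc zero}  {zero}      a≡0⇔b≡0 with () ← Equivalence.from a≡0⇔b≡0 refl
≡0⇔≡0⇒≡ {suc zero}  {suc zero}  _ = refl

AcceptsFrom : (M : NFA n) → Fin (states M) → List (Fin n) → Set
AcceptsFrom M q w = ∃ λ q′ → Run M q w q′ × accepting M q′ ≡ true

Accepts-++⁻ : (M : NFA n) (u : List (Fin n)) {v : List (Fin n)} →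
  Accepts M (u ++ v) → ∃ λ q → Run M (start M) u q × AcceptsFrom M q v
Accepts-++⁻ M u (accepts {q = final} run acc) = go u run
  where
  go : ∀ {q} u {v} → Run M q (u ++ v) final → ∃ λ q′ → Run M q u q′ × AcceptsFrom M q′ v
  go []      run              = _ , run-nil , _ , run , acc
  go (_ ∷ u) (run-cons δ run) with q′ , runᵤ , accᵥ ← go u run = q′ , run-cons δ runᵤ , accᵥ

Accepts-++⁺ : (M : NFA n) {u v : List (Fin n)} {q : Fin (states M)} →
  Run M (start M) u q → AcceptsFrom M q v → Accepts M (u ++ v)
Accepts-++⁺ M runᵤ (_ , runᵥ , acc) = accepts (join runᵤ runᵥ) acc
  where
  join : ∀ {q q′ q″ u v} → Run M q u q′ → Run M q′ v q″ → Run M q (u ++ v) q″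
  join run-nil          runᵥ = runᵥ
  join (run-cons δ run) runᵥ = run-cons δ (join run runᵥ)

fooling-set⇒≤states : (M : NFA n) (x y : Fin m → List (Fin n)) →
  (∀ i → Accepts M (x i ++ y i)) →
  (∀ i j → Accepts M (x i ++ y j) → i ≡ j) →
  m ≤ states M
fooling-set⇒≤states M x y xy∈L xy∈L⇒≡ = injective⇒≤ cut-injective
  where
  cut : ∀ i → ∃ λ q → Run M (start M) (x i) q × AcceptsFrom M q (y i)
  cut i = Accepts-++⁻ M (x i) (xy∈L i)

  cut-injective : Injective _≡_ _≡_ (proj₁ ∘ cut)
  cut-injective {i} {j} eq = xy∈L⇒≡ i j
    (Accepts-++⁺ M (subst (Run M (start M) (x i)) eq (proj₁ (proj₂ (cut i))))
                   (proj₂ (proj₂ (cut j))))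

theorem4p2 : (k n : ℕ) → k ≤ n → (M : NFA n) → Recognises M k → 2 ^ k ≤ states M
theorem4p2 k n k≤n M L≡Lk = fooling-set⇒≤states M x y xy∈L xy∈L⇒≡
  where
  coloured : (i : Fin (2 ^ k)) → Decidable (λ a → finToFun i a ≡ zero)
  coloured i a = finToFun i a ≟ zero

  embed : Fin k → Fin n
  embed a = inject≤ a k≤n

  x y : Fin (2 ^ k) → List (Fin n)
  x i = map embed (elements (coloured i))
  y i = map embed (elements (∁? (coloured i)))

  xy≡ : ∀ i j → map embed (elements (coloured i) ++ elements (∁? (coloured j))) ≡ x i ++ y j
  xy≡ i j = map-++ embed (elements (coloured i)) _

  xy∈L : ∀ i → Accepts M (x i ++ y i)
  xy∈L i = Equivalence.from (L≡Lk _) (subst (InLk k n) (xy≡ i i)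
    (InLk-map⁺ (inject≤-injective k≤n k≤n _ _) (elements++elements-∁∈Lk (coloured i))))

  xy∈L⇒≡ : ∀ i j → Accepts M (x i ++ y j) → i ≡ j
  xy∈L⇒≡ i j acc = finToFun-injective {m = 2} {n = k} λ a → ≡0⇔≡0⇒≡
    (elements++elements-∁∈Lk⇒⇔ (coloured i) (coloured j)
      (InLk-map⁻ (subst (InLk k n) (sym (xy≡ i j)) (Equivalence.to (L≡Lk _) acc))) a)
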